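{- Let $A\subseteq\mathbb{F}_2^n$ be nonempty with $|A+A| = K|A|$. Let $\beta_1,\beta_2,\beta_3,\beta_4$ be chosen independently and uniformly at random from $A$, let $Y := |A(\beta_1+\beta_2)\cap A(\beta_3+\beta_4)|$, and let $Z := 0$ if $|A(\beta_1+\beta_2)|\le \frac{|A|}{2K}$ or $|A(\beta_3+\beta_4)|\le \frac{|A|}{2K}$, and $Z:=Y$ otherwise. Then $\mathbb{E}[Z] \ge \frac{|A|}{16K^2}$.
   Context: $A+A=\{a_1+a_2 : a_1,a_2\in A\}$. For $s\in\mathbb{F}_2^n$, $A(s) := A\cap(s+A) = \{a\in A : \exists a'\in A,\ s=a+a'\}$. -}

module Defs where

open import Data.Bool using (Bool; true; false; _xor_; _∧_; _∨_; if_then_else_)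
open import Data.Nat using (ℕ; zero; suc; _+_; _*_; _^_; _≤ᵇ_)
open import Data.List using (List; []; _∷_; map; concatMap)
open import Data.Nat.ListAction using (sum)
open import Data.Bool.ListAction using (any)
open import Data.Vec using (Vec; []; _∷_; zipWith)

F₂^ : ℕ → Set
F₂^ n = Vec Bool n

infixl 6 _⊕_
_⊕_ : ∀ {n} → F₂^ n → F₂^ n → F₂^ n
_⊕_ = zipWith _xor_

allVecs : (n : ℕ) → List (F₂^ n)
allVecs zero = [] ∷ []
allVecs (suc n) = concatMap (λ v → (false ∷ v) ∷ (true ∷ v) ∷ []) (allVecs n)

Subset : ℕ → Set
Subset n = F₂^ n → Bool

card : ∀ {n} → Subset n → ℕ
card {n} A = sum (map (λ v → if A v then 1 else 0) (allVecs n))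

_∩_ : ∀ {n} → Subset n → Subset n → Subset n
(A ∩ B) x = A x ∧ B x

-- Sumset A + A = { a₁ + a₂ : a₁, a₂ ∈ A }.
-- x ∈ A + A iff there is a ∈ A with x + a ∈ A (since x = a + (x + a) in F_2^n).
sumset : ∀ {n} → Subset n → Subset n
sumset {n} A x = any (λ a → A a ∧ A (x ⊕ a)) (allVecs n)

Aof : ∀ {n} → Subset n → F₂^ n → Subset n
Aof A s a = A a ∧ A (s ⊕ a)

-- "|A(s)| ≤ |A| / (2K)" where K = |A+A| / |A|, i.e. 2 |A(s)| |A+A| ≤ |A|^2.
small : ∀ {n} → Subset n → F₂^ n → Bool
small A s = (2 * card (Aof A s) * card (sumset A)) ≤ᵇ (card A ^ 2)

Zval : ∀ {n} → Subset n → F₂^ n → F₂^ n → F₂^ n → F₂^ n → ℕ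
Zval A b₁ b₂ b₃ b₄ =
  if small A (b₁ ⊕ b₂) ∨ small A (b₃ ⊕ b₄)
  then 0
  else card (Aof A (b₁ ⊕ b₂) ∩ Aof A (b₃ ⊕ b₄))

sumOver : ∀ {n} → Subset n → (F₂^ n → ℕ) → ℕ
sumOver {n} A f = sum (map (λ a → if A a then f a else 0) (allVecs n))

-- Σ_{(β₁,β₂,β₃,β₄) ∈ A⁴} Z  ( = |A|^4 · E[Z] ).
Zsum : ∀ {n} → Subset n → ℕ
Zsum A =
  sumOver A λ b₁ → sumOver A λ b₂ → sumOver A λ b₃ → sumOver A λ b₄ →
    Zval A b₁ b₂ b₃ b₄

-- Write r(s) = |A(s)|, the number of representations s = a + a' with a, a' ∈ A, so that
-- Σ_s r(s) = |A|², and call s popular when r(s) > |A|/(2K).  The unpopular s contribute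
-- at most |A+A| · |A|/(2K) = |A|²/2 to that sum, so the popular part U = Σ_{s popular} r(s)
-- is at least |A|²/2.  Cauchy–Schwarz over s ∈ A+A gives U² ≤ |A+A| · V with
-- V = Σ_{s popular} r(s)², and V = Σ_{a ∈ A} g(a) with g(a) = Σ_{s popular, a ∈ A(s)} r(s).
-- Cauchy–Schwarz over a ∈ A then gives V² ≤ |A| · Σ_a g(a)², and expanding g(a)² shows
-- Σ_a g(a)² = Σ_{β₁…β₄} Z.  Chaining, |A|⁸ ≤ 16 |A+A|² |A| Σ Z.
module Submission where

open import Defs
open import Data.Bool using (Bool; true; false; _xor_; _∧_; _∨_; not; if_then_else_; T)
open import Data.Bool.Properties using (xor-assoc; xor-same; xor-comm)
open import Data.Bool.ListAction using (any)
open import Data.List using ([]; _∷_; map; concatMap)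
open import Data.Nat using (ℕ; zero; suc; _+_; _*_; _^_; _∸_; _≤_; _<_; z≤n; s≤s; >-nonZero)
open import Data.Nat.ListAction using (sum)
open import Data.Nat.Properties
open import Data.Nat.Tactic.RingSolver using (solve-∀)
open import Data.Sum using ([_,_]′)
open import Data.Unit using (tt)
open import Data.Vec using ([]; _∷_)
open import Data.Vec.Properties using (zipWith-comm)
open import Relation.Binary.PropositionalEquality

∑ : (n : ℕ) → (F₂^ n → ℕ) → ℕ
∑ zero    f = f []
∑ (suc n) f = ∑ n (λ v → f (false ∷ v) + f (true ∷ v))

sum-allVecs : ∀ n (f : F₂^ n → ℕ) → sum (map f (allVecs n)) ≡ ∑ n f
sum-allVecs zero    f = +-identityʳ (f [])
sum-allVecs (suc n) f = trans (sum-doubled (allVecs n)) (sum-allVecs n _)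
  where
  sum-doubled : ∀ vs →
    sum (map f (concatMap (λ v → (false ∷ v) ∷ (true ∷ v) ∷ []) vs))
    ≡ sum (map (λ v → f (false ∷ v) + f (true ∷ v)) vs)
  sum-doubled []       = refl
  sum-doubled (v ∷ vs) = trans (sym (+-assoc (f (false ∷ v)) (f (true ∷ v)) _))
                               (cong (f (false ∷ v) + f (true ∷ v) +_) (sum-doubled vs))

∑-cong : ∀ n {f g : F₂^ n → ℕ} → (∀ v → f v ≡ g v) → ∑ n f ≡ ∑ n g
∑-cong zero    f≡g = f≡g []
∑-cong (suc n) f≡g = ∑-cong n (λ v → cong₂ _+_ (f≡g (false ∷ v)) (f≡g (true ∷ v)))

∑-mono-≤ : ∀ n {f g : F₂^ n → ℕ} → (∀ v → f v ≤ g v) → ∑ n f ≤ ∑ n g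
∑-mono-≤ zero    f≤g = f≤g []
∑-mono-≤ (suc n) f≤g = ∑-mono-≤ n (λ v → +-mono-≤ (f≤g (false ∷ v)) (f≤g (true ∷ v)))

∑-distrib-+ : ∀ n (f g : F₂^ n → ℕ) → ∑ n (λ v → f v + g v) ≡ ∑ n f + ∑ n g
∑-distrib-+ zero    f g = refl
∑-distrib-+ (suc n) f g =
  trans (∑-cong n (λ v → interchange (f (false ∷ v)) (f (true ∷ v)) (g (false ∷ v)) (g (true ∷ v))))
        (∑-distrib-+ n _ _)
  where
  interchange : ∀ a b c d → a + c + (b + d) ≡ (a + b) + (c + d)
  interchange = solve-∀

*-distribˡ-∑ : ∀ n c (f : F₂^ n → ℕ) → c * ∑ n f ≡ ∑ n (λ v → c * f v)
*-distribˡ-∑ zero    c f = refl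
*-distribˡ-∑ (suc n) c f =
  trans (*-distribˡ-∑ n c _) (∑-cong n (λ v → *-distribˡ-+ c (f (false ∷ v)) (f (true ∷ v))))

*-distribʳ-∑ : ∀ n c (f : F₂^ n → ℕ) → ∑ n f * c ≡ ∑ n (λ v → f v * c)
*-distribʳ-∑ n c f =
  trans (*-comm (∑ n f) c) (trans (*-distribˡ-∑ n c f) (∑-cong n (λ v → *-comm c (f v))))

∑-comm : ∀ n m (f : F₂^ n → F₂^ m → ℕ) →
         ∑ n (λ x → ∑ m (λ y → f x y)) ≡ ∑ m (λ y → ∑ n (λ x → f x y))
∑-comm zero    m f = refl
∑-comm (suc n) m f =
  trans (∑-cong n (λ x → sym (∑-distrib-+ m (f (false ∷ x)) (f (true ∷ x))))) (∑-comm n m _)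

∑-*-∑ : ∀ n m (f : F₂^ n → ℕ) (g : F₂^ m → ℕ) →
        ∑ n f * ∑ m g ≡ ∑ n (λ x → ∑ m (λ y → f x * g y))
∑-*-∑ n m f g =
  trans (*-distribʳ-∑ n (∑ m g) f) (∑-cong n (λ x → *-distribˡ-∑ m (f x) g))

∑-translate : ∀ n (c : F₂^ n) (f : F₂^ n → ℕ) → ∑ n (λ v → f (c ⊕ v)) ≡ ∑ n f
∑-translate zero    []          f = refl
∑-translate (suc n) (false ∷ c) f = ∑-translate n c _
∑-translate (suc n) (true ∷ c)  f =
  trans (∑-cong n (λ v → +-comm (f (true ∷ (c ⊕ v))) _)) (∑-translate n c _)

⊕-comm : ∀ {n} (u v : F₂^ n) → u ⊕ v ≡ v ⊕ u
⊕-comm = zipWith-comm xor-comm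

⊕-cancelˡ : ∀ {n} (u v : F₂^ n) → u ⊕ (u ⊕ v) ≡ v
⊕-cancelˡ []      []      = refl
⊕-cancelˡ (x ∷ u) (y ∷ v) =
  cong₂ _∷_ (trans (sym (xor-assoc x x y)) (cong (_xor y) (xor-same x))) (⊕-cancelˡ u v)

2*[m*n]≤m*m+n*n : ∀ m n → 2 * (m * n) ≤ m * m + n * n
2*[m*n]≤m*m+n*n m n = [ ordered , swapped ]′ (≤-total m n)
  where
  ordered : ∀ {a b} → a ≤ b → 2 * (a * b) ≤ a * a + b * b
  ordered {a} {b} a≤b = subst (λ k → 2 * (a * k) ≤ a * a + k * k) (m+[n∸m]≡n a≤b) (begin
      2 * (a * (a + d))           ≤⟨ m≤m+n _ (d * d) ⟩
      2 * (a * (a + d)) + d * d   ≡⟨ square-of-sum a d ⟩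
      a * a + (a + d) * (a + d)   ∎)
    where
    open ≤-Reasoning
    d : ℕ
    d = b ∸ a
    square-of-sum : ∀ a d → 2 * (a * (a + d)) + d * d ≡ a * a + (a + d) * (a + d)
    square-of-sum = solve-∀
  swapped : n ≤ m → 2 * (m * n) ≤ m * m + n * n
  swapped n≤m = subst₂ _≤_ (cong (2 *_) (*-comm n m)) (+-comm (n * n) (m * m)) (ordered n≤m)

-- Summing 2 (f i g j)(f j g i) ≤ (f i g j)² + (f j g i)² over all pairs (i, j).
cauchy-schwarz : ∀ n (f g : F₂^ n → ℕ) →
  ∑ n (λ i → f i * g i) * ∑ n (λ i → f i * g i) ≤ ∑ n (λ i → f i * f i) * ∑ n (λ i → g i * g i)
cauchy-schwarz n f g = *-cancelˡ-≤ 2 (begin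
    2 * (P * P)
      ≡⟨ cong (2 *_) (∑-*-∑ n n _ _) ⟩
    2 * ∑ n (λ i → ∑ n (λ j → f i * g i * (f j * g j)))
      ≡⟨ trans (*-distribˡ-∑ n 2 _) (∑-cong n (λ i → *-distribˡ-∑ n 2 _)) ⟩
    ∑ n (λ i → ∑ n (λ j → 2 * (f i * g i * (f j * g j))))
      ≤⟨ ∑-mono-≤ n (λ i → ∑-mono-≤ n (λ j → pairwise i j)) ⟩
    ∑ n (λ i → ∑ n (λ j → f i * f i * (g j * g j) + g i * g i * (f j * f j)))
      ≡⟨ trans (∑-cong n (λ i → ∑-distrib-+ n _ _)) (∑-distrib-+ n _ _) ⟩
    ∑ n (λ i → ∑ n (λ j → f i * f i * (g j * g j))) + ∑ n (λ i → ∑ n (λ j → g i * g i * (f j * f j)))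
      ≡⟨ sym (cong₂ _+_ (∑-*-∑ n n _ _) (∑-*-∑ n n _ _)) ⟩
    F * G + G * F
      ≡⟨ cong (F * G +_) (trans (*-comm G F) (sym (+-identityʳ (F * G)))) ⟩
    2 * (F * G) ∎)
  where
  open ≤-Reasoning
  P F G : ℕ
  P = ∑ n (λ i → f i * g i)
  F = ∑ n (λ i → f i * f i)
  G = ∑ n (λ i → g i * g i)
  lhs-form : ∀ a b c d → 2 * (a * d * (c * b)) ≡ 2 * (a * b * (c * d))
  lhs-form = solve-∀
  rhs-form : ∀ a b c d → a * d * (a * d) + c * b * (c * b) ≡ a * a * (d * d) + b * b * (c * c)
  rhs-form = solve-∀
  pairwise : ∀ i j → 2 * (f i * g i * (f j * g j)) ≤ f i * f i * (g j * g j) + g i * g i * (f j * f j)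
  pairwise i j = subst₂ _≤_ (lhs-form (f i) (g i) (f j) (g j)) (rhs-form (f i) (g i) (f j) (g j))
                   (2*[m*n]≤m*m+n*n (f i * g j) (f j * g i))

χ : Bool → ℕ
χ b = if b then 1 else 0

χ-∧ : ∀ a b → χ (a ∧ b) ≡ χ a * χ b
χ-∧ false b     = refl
χ-∧ true  false = refl
χ-∧ true  true  = refl

χ-idem : ∀ b → χ b * χ b ≡ χ b
χ-idem false = refl
χ-idem true  = refl

χ-≤1 : ∀ b → χ b ≤ 1
χ-≤1 false = z≤n
χ-≤1 true  = s≤s z≤n

χ-not+χ : ∀ b → χ (not b) + χ b ≡ 1
χ-not+χ false = refl
χ-not+χ true  = refl

if-then-0 : ∀ b x → (if b then x else 0) ≡ χ b * x
if-then-0 false x = refl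
if-then-0 true  x = sym (+-identityʳ x)

if-∨-then-0 : ∀ a b x → (if a ∨ b then 0 else x) ≡ χ (not a) * (χ (not b) * x)
if-∨-then-0 true  b     x = refl
if-∨-then-0 false true  x = refl
if-∨-then-0 false false x = sym (trans (+-identityʳ _) (+-identityʳ x))

count-any-false : ∀ {X : Set} (P : X → Bool) xs → any P xs ≡ false → sum (map (λ x → χ (P x)) xs) ≡ 0
count-any-false P []       _ = refl
count-any-false P (x ∷ xs) none with P x
... | false = count-any-false P xs none

card-∑ : ∀ {n} (B : Subset n) → card B ≡ ∑ n (λ v → χ (B v))
card-∑ {n} B = sum-allVecs n _

sumOver-∑ : ∀ {n} (B : Subset n) f → sumOver B f ≡ ∑ n (λ v → χ (B v) * f v)
sumOver-∑ {n} B f = trans (sum-allVecs n _) (∑-cong n (λ v → if-then-0 (B v) (f v)))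

module _ {n : ℕ} (A : Subset n) where

  χA : F₂^ n → ℕ
  χA a = χ (A a)

  N : ℕ
  N = card A

  S : ℕ
  S = card (sumset A)

  φ : F₂^ n → F₂^ n → ℕ
  φ s a = χA a * χA (s ⊕ a)

  r : F₂^ n → ℕ
  r s = ∑ n (φ s)

  card-Aof : ∀ s → card (Aof A s) ≡ r s
  card-Aof s = trans (card-∑ (Aof A s)) (∑-cong n (λ a → χ-∧ (A a) (A (s ⊕ a))))

  ∑-convolution : (h : F₂^ n → ℕ) →
    ∑ n (λ b₁ → χA b₁ * ∑ n (λ b₂ → χA b₂ * h (b₁ ⊕ b₂))) ≡ ∑ n (λ s → r s * h s)
  ∑-convolution h = begin
      ∑ n (λ b₁ → χA b₁ * ∑ n (λ b₂ → χA b₂ * h (b₁ ⊕ b₂)))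
    ≡⟨ ∑-cong n (λ b₁ → cong (χA b₁ *_) (sym (∑-translate n b₁ _))) ⟩
      ∑ n (λ b₁ → χA b₁ * ∑ n (λ s → χA (b₁ ⊕ s) * h (b₁ ⊕ (b₁ ⊕ s))))
    ≡⟨ ∑-cong n (λ b₁ → trans (*-distribˡ-∑ n (χA b₁) _) (∑-cong n (λ s → regroup b₁ s))) ⟩
      ∑ n (λ b₁ → ∑ n (λ s → φ s b₁ * h s))
    ≡⟨ ∑-comm n n _ ⟩
      ∑ n (λ s → ∑ n (λ b₁ → φ s b₁ * h s))
    ≡⟨ ∑-cong n (λ s → sym (*-distribʳ-∑ n (h s) (φ s))) ⟩
      ∑ n (λ s → r s * h s)
    ∎
    where
    open ≡-Reasoning
    regroup : ∀ b s → χA b * (χA (b ⊕ s) * h (b ⊕ (b ⊕ s))) ≡ φ s b * h s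
    regroup b s = begin
        χA b * (χA (b ⊕ s) * h (b ⊕ (b ⊕ s)))
      ≡⟨ cong₂ (λ c k → χA b * (χA c * h k)) (⊕-comm b s) (⊕-cancelˡ b s) ⟩
        χA b * (χA (s ⊕ b) * h s)
      ≡⟨ sym (*-assoc (χA b) _ (h s)) ⟩
        φ s b * h s
      ∎

  ∑-χA : ∑ n χA ≡ N
  ∑-χA = sym (card-∑ A)

  ∑-r : ∑ n r ≡ N * N
  ∑-r = begin
      ∑ n r                                   ≡⟨ ∑-cong n (λ s → sym (*-identityʳ (r s))) ⟩
      ∑ n (λ s → r s * 1)                     ≡⟨ sym (∑-convolution (λ _ → 1)) ⟩
      ∑ n (λ b₁ → χA b₁ * ∑ n (λ b₂ → χA b₂ * 1))
        ≡⟨ ∑-cong n (λ b₁ → cong (χA b₁ *_) (trans (∑-cong n (λ b₂ → *-identityʳ (χA b₂))) ∑-χA)) ⟩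
      ∑ n (λ b₁ → χA b₁ * N)                  ≡⟨ sym (*-distribʳ-∑ n N χA) ⟩
      ∑ n χA * N                              ≡⟨ cong (_* N) ∑-χA ⟩
      N * N                                   ∎
    where open ≡-Reasoning

  r≤N : ∀ s → r s ≤ N
  r≤N s = subst (r s ≤_) ∑-χA (∑-mono-≤ n (λ a →
            subst (φ s a ≤_) (*-identityʳ (χA a)) (*-monoʳ-≤ (χA a) (χ-≤1 (A (s ⊕ a))))))

  r-outside-sumset : ∀ {s} → sumset A s ≡ false → r s ≡ 0
  r-outside-sumset {s} s∉A+A = begin
      r s                                                     ≡⟨ ∑-cong n (λ a → sym (χ-∧ (A a) (A (s ⊕ a)))) ⟩
      ∑ n (λ a → χ (A a ∧ A (s ⊕ a)))                         ≡⟨ sym (sum-allVecs n _) ⟩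
      sum (map (λ a → χ (A a ∧ A (s ⊕ a))) (allVecs n))       ≡⟨ count-any-false _ (allVecs n) s∉A+A ⟩
      0                                                       ∎
    where open ≡-Reasoning

  r≤[A+A]*N : ∀ s → r s ≤ χ (sumset A s) * N
  r≤[A+A]*N s with sumset A s in s∈?A+A
  ... | true  = subst (r s ≤_) (sym (+-identityʳ N)) (r≤N s)
  ... | false = ≤-reflexive (r-outside-sumset s∈?A+A)

  sumset-nonempty : 0 < N → 0 < S
  sumset-nonempty 0<N = <-≤-trans 0<N (*-cancelʳ-≤ N S N {{>-nonZero 0<N}} N*N≤S*N)
    where
    open ≤-Reasoning
    N*N≤S*N : N * N ≤ S * N
    N*N≤S*N = begin
      N * N                                  ≡⟨ sym ∑-r ⟩
      ∑ n r                                  ≤⟨ ∑-mono-≤ n r≤[A+A]*N ⟩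
      ∑ n (λ s → χ (sumset A s) * N)         ≡⟨ sym (*-distribʳ-∑ n N _) ⟩
      ∑ n (λ s → χ (sumset A s)) * N         ≡⟨ cong (_* N) (sym (card-∑ (sumset A))) ⟩
      S * N                                  ∎

  small⇒2*r*S≤N*N : ∀ {s} → small A s ≡ true → 2 * r s * S ≤ N * N
  small⇒2*r*S≤N*N {s} s-small =
    subst₂ _≤_ (cong (λ k → 2 * k * S) (card-Aof s)) (cong (N *_) (*-identityʳ N))
      (≤ᵇ⇒≤ _ _ (subst T (sym s-small) tt))

  u : F₂^ n → ℕ
  u s = χ (not (small A s)) * r s

  w : F₂^ n → ℕ
  w s = χ (small A s) * r s

  U : ℕ
  U = ∑ n u

  N*N≡U+∑w : N * N ≡ U + ∑ n w
  N*N≡U+∑w = begin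
      N * N                    ≡⟨ sym ∑-r ⟩
      ∑ n r                    ≡⟨ ∑-cong n split ⟩
      ∑ n (λ s → u s + w s)    ≡⟨ ∑-distrib-+ n u w ⟩
      U + ∑ n w                ∎
    where
    open ≡-Reasoning
    split : ∀ s → r s ≡ u s + w s
    split s = sym (trans (sym (*-distribʳ-+ (r s) (χ (not (small A s))) (χ (small A s))))
                         (trans (cong (_* r s) (χ-not+χ (small A s))) (*-identityˡ (r s))))

  [small]*2*r*S≤[A+A]*N*N : ∀ s → χ (small A s) * (2 * r s * S) ≤ χ (sumset A s) * (N * N)
  [small]*2*r*S≤[A+A]*N*N s with small A s in s-small | sumset A s in s∈?A+A
  ... | false | _     = z≤n
  ... | true  | true  = +-monoˡ-≤ 0 (small⇒2*r*S≤N*N s-small)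
  ... | true  | false = subst (λ k → 2 * k * S + 0 ≤ 0) (sym (r-outside-sumset s∈?A+A)) z≤n

  unpopular-sums-at-most-half : 0 < N → 2 * ∑ n w ≤ N * N
  unpopular-sums-at-most-half 0<N = *-cancelˡ-≤ S {{>-nonZero (sumset-nonempty 0<N)}} (begin
      S * (2 * ∑ n w)                                 ≡⟨ regroup ⟩
      ∑ n (λ s → χ (small A s) * (2 * r s * S))        ≤⟨ ∑-mono-≤ n [small]*2*r*S≤[A+A]*N*N ⟩
      ∑ n (λ s → χ (sumset A s) * (N * N))            ≡⟨ sym (*-distribʳ-∑ n (N * N) _) ⟩
      ∑ n (λ s → χ (sumset A s)) * (N * N)            ≡⟨ cong (_* (N * N)) (sym (card-∑ (sumset A))) ⟩
      S * (N * N)                                     ∎)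
    where
    open ≤-Reasoning
    reorder : ∀ S c r → S * 2 * (c * r) ≡ c * (2 * r * S)
    reorder = solve-∀
    regroup : S * (2 * ∑ n w) ≡ ∑ n (λ s → χ (small A s) * (2 * r s * S))
    regroup = trans (sym (*-assoc S 2 _))
                (trans (*-distribˡ-∑ n (S * 2) w) (∑-cong n (λ s → reorder S (χ (small A s)) (r s))))

  popular-sums-cover-half : 0 < N → N * N ≤ 2 * U
  popular-sums-cover-half 0<N = +-cancelʳ-≤ (N * N) (N * N) (2 * U) (begin
      N * N + N * N          ≡⟨ cong (N * N +_) (sym (+-identityʳ (N * N))) ⟩
      2 * (N * N)            ≡⟨ cong (2 *_) N*N≡U+∑w ⟩
      2 * (U + ∑ n w)        ≡⟨ *-distribˡ-+ 2 U (∑ n w) ⟩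
      2 * U + 2 * ∑ n w      ≤⟨ +-monoʳ-≤ (2 * U) (unpopular-sums-at-most-half 0<N) ⟩
      2 * U + N * N          ∎)
    where open ≤-Reasoning

  V : ℕ
  V = ∑ n (λ s → u s * r s)

  u-supported : ∀ s → χ (sumset A s) * u s ≡ u s
  u-supported s with sumset A s in s∈?A+A
  ... | true  = +-identityʳ (u s)
  ... | false = sym (trans (cong (χ (not (small A s)) *_) (r-outside-sumset s∈?A+A))
                           (*-zeroʳ (χ (not (small A s)))))

  u*u≡u*r : ∀ s → u s * u s ≡ u s * r s
  u*u≡u*r s with small A s
  ... | false = cong ((r s + 0) *_) (+-identityʳ (r s))
  ... | true  = refl

  U*U≤S*V : U * U ≤ S * V
  U*U≤S*V = subst₂ _≤_ (cong₂ _*_ ∑χu ∑χu) (cong₂ _*_ ∑χχ (∑-cong n u*u≡u*r))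
              (cauchy-schwarz n (λ s → χ (sumset A s)) u)
    where
    ∑χu : ∑ n (λ s → χ (sumset A s) * u s) ≡ U
    ∑χu = ∑-cong n u-supported
    ∑χχ : ∑ n (λ s → χ (sumset A s) * χ (sumset A s)) ≡ S
    ∑χχ = trans (∑-cong n (λ s → χ-idem (sumset A s))) (sym (card-∑ (sumset A)))

  g : F₂^ n → ℕ
  g a = ∑ n (λ s → u s * φ s a)

  g-supported : ∀ a → χA a * g a ≡ g a
  g-supported a = trans (*-distribˡ-∑ n (χA a) _) (∑-cong n absorb)
    where
    reorder : ∀ x u y → x * (u * (x * y)) ≡ u * (x * x * y)
    reorder = solve-∀
    absorb : ∀ s → χA a * (u s * φ s a) ≡ u s * φ s a
    absorb s = trans (reorder (χA a) (u s) (χA (s ⊕ a)))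
                     (cong (λ k → u s * (k * χA (s ⊕ a))) (χ-idem (A a)))

  ∑g≡V : ∑ n g ≡ V
  ∑g≡V = trans (∑-comm n n _) (∑-cong n (λ s → sym (*-distribˡ-∑ n (u s) (φ s))))

  C : F₂^ n → F₂^ n → ℕ
  C s t = ∑ n (λ a → φ s a * φ t a)

  W : ℕ
  W = ∑ n (λ s → ∑ n (λ t → u s * u t * C s t))

  ∑g*g≡W : ∑ n (λ a → g a * g a) ≡ W
  ∑g*g≡W = begin
      ∑ n (λ a → g a * g a)
    ≡⟨ ∑-cong n (λ a → ∑-*-∑ n n _ _) ⟩
      ∑ n (λ a → ∑ n (λ s → ∑ n (λ t → u s * φ s a * (u t * φ t a))))
    ≡⟨ trans (∑-comm n n _) (∑-cong n (λ s → ∑-comm n n _)) ⟩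
      ∑ n (λ s → ∑ n (λ t → ∑ n (λ a → u s * φ s a * (u t * φ t a))))
    ≡⟨ ∑-cong n (λ s → ∑-cong n (λ t → trans (∑-cong n (λ a → reorder (u s) (φ s a) (u t) (φ t a)))
                                              (sym (*-distribˡ-∑ n (u s * u t) _)))) ⟩
      W
    ∎
    where
    open ≡-Reasoning
    reorder : ∀ a b c d → a * b * (c * d) ≡ a * c * (b * d)
    reorder = solve-∀

  V*V≤N*∑g*g : V * V ≤ N * ∑ n (λ a → g a * g a)
  V*V≤N*∑g*g = subst₂ _≤_ (cong₂ _*_ ∑χg ∑χg) (cong (_* ∑ n (λ a → g a * g a)) ∑χχ) (cauchy-schwarz n χA g)
    where
    ∑χg : ∑ n (λ a → χA a * g a) ≡ V
    ∑χg = trans (∑-cong n g-supported) ∑g≡V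
    ∑χχ : ∑ n (λ a → χA a * χA a) ≡ N
    ∑χχ = trans (∑-cong n (λ a → χ-idem (A a))) ∑-χA

  card-Aof∩Aof : ∀ s t → card (Aof A s ∩ Aof A t) ≡ C s t
  card-Aof∩Aof s t = trans (card-∑ (Aof A s ∩ Aof A t)) (∑-cong n (λ a →
    trans (χ-∧ (Aof A s a) (Aof A t a)) (cong₂ _*_ (χ-∧ (A a) (A (s ⊕ a))) (χ-∧ (A a) (A (t ⊕ a))))))

  Z : F₂^ n → F₂^ n → ℕ
  Z s t = χ (not (small A s)) * (χ (not (small A t)) * C s t)

  Zval≡Z : ∀ b₁ b₂ b₃ b₄ → Zval A b₁ b₂ b₃ b₄ ≡ Z (b₁ ⊕ b₂) (b₃ ⊕ b₄)
  Zval≡Z b₁ b₂ b₃ b₄ =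
    trans (if-∨-then-0 (small A (b₁ ⊕ b₂)) (small A (b₃ ⊕ b₄)) _)
          (cong (λ k → χ (not (small A (b₁ ⊕ b₂))) * (χ (not (small A (b₃ ⊕ b₄))) * k))
                (card-Aof∩Aof (b₁ ⊕ b₂) (b₃ ⊕ b₄)))

  sumOver-A : ∀ {f f′ : F₂^ n → ℕ} → (∀ a → f a ≡ f′ a) → sumOver A f ≡ ∑ n (λ a → χA a * f′ a)
  sumOver-A {f} f≡f′ = trans (sumOver-∑ A f) (∑-cong n (λ a → cong (χA a *_) (f≡f′ a)))

  Zsum≡W : Zsum A ≡ W
  Zsum≡W = begin
      Zsum A
    ≡⟨ sumOver-A (λ b₁ → sumOver-A (λ b₂ →
         trans (sumOver-A (λ b₃ → sumOver-A (λ b₄ → Zval≡Z b₁ b₂ b₃ b₄)))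
               (∑-convolution (Z (b₁ ⊕ b₂))))) ⟩
      ∑ n (λ b₁ → χA b₁ * ∑ n (λ b₂ → χA b₂ * ∑ n (λ t → r t * Z (b₁ ⊕ b₂) t)))
    ≡⟨ ∑-convolution (λ s → ∑ n (λ t → r t * Z s t)) ⟩
      ∑ n (λ s → r s * ∑ n (λ t → r t * Z s t))
    ≡⟨ ∑-cong n (λ s → trans (*-distribˡ-∑ n (r s) _)
         (∑-cong n (λ t → reorder (r s) (r t) (χ (not (small A s))) (χ (not (small A t))) (C s t)))) ⟩
      W
    ∎
    where
    open ≡-Reasoning
    reorder : ∀ r r′ p p′ c → r * (r′ * (p * (p′ * c))) ≡ p * r * (p′ * r′) * c
    reorder = solve-∀

  V*V≤N*Zsum : V * V ≤ N * Zsum A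
  V*V≤N*Zsum = subst (λ k → V * V ≤ N * k) (trans ∑g*g≡W (sym Zsum≡W)) V*V≤N*∑g*g

eliminate-U-V : ∀ N S U V Z → 0 < N → N * N ≤ 2 * U → U * U ≤ S * V → V * V ≤ N * Z →
                N ^ 7 ≤ 16 * S ^ 2 * Z
eliminate-U-V N S U V Z 0<N N*N≤2*U U*U≤S*V V*V≤N*Z =
  *-cancelˡ-≤ N {{>-nonZero 0<N}} (begin
    N * N ^ 7                                   ≡⟨ eighth-power N ⟩
    N * N * (N * N) * (N * N * (N * N))         ≤⟨ *-mono-≤ N⁴≤4*S*V N⁴≤4*S*V ⟩
    4 * (S * V) * (4 * (S * V))                 ≡⟨ square-of-4SV S V ⟩
    16 * S ^ 2 * (V * V)                        ≤⟨ *-monoʳ-≤ (16 * S ^ 2) V*V≤N*Z ⟩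
    16 * S ^ 2 * (N * Z)                        ≡⟨ pull-N N (16 * S ^ 2) Z ⟩
    N * (16 * S ^ 2 * Z)                        ∎)
  where
  open ≤-Reasoning
  eighth-power : ∀ x → x * (x * (x * (x * (x * (x * (x * (x * 1))))))) ≡ x * x * (x * x) * (x * x * (x * x))
  eighth-power = solve-∀
  four-U² : ∀ x → 2 * x * (2 * x) ≡ 4 * (x * x)
  four-U² = solve-∀
  square-of-4SV : ∀ x y → 4 * (x * y) * (4 * (x * y)) ≡ 16 * (x * (x * 1)) * (y * y)
  square-of-4SV = solve-∀
  pull-N : ∀ x c z → c * (x * z) ≡ x * (c * z)
  pull-N = solve-∀
  N⁴≤4*S*V : N * N * (N * N) ≤ 4 * (S * V)
  N⁴≤4*S*V = begin
    N * N * (N * N)          ≤⟨ *-mono-≤ N*N≤2*U N*N≤2*U ⟩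
    2 * U * (2 * U)          ≡⟨ four-U² U ⟩
    4 * (U * U)              ≤⟨ *-monoʳ-≤ 4 U*U≤S*V ⟩
    4 * (S * V)              ∎

lemma2p2 : (n : ℕ) (A : Subset n) → 0 < card A →
           card A ^ 7 ≤ 16 * card (sumset A) ^ 2 * Zsum A
lemma2p2 n A 0<|A| =
  eliminate-U-V (N A) (S A) (U A) (V A) (Zsum A) 0<|A|
    (popular-sums-cover-half A 0<|A|) (U*U≤S*V A) (V*V≤N*Zsum A)
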